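{- Let $\approx$ be an SCER on $\Sigma^*$ and $T$ a string. If $C\in\mathsf{Cov}_{\approx}(T)$, $B\in\mathsf{Bord}_{\approx}(T)$, and $|C|\le|B|$, then $C\in\mathsf{Cov}_{\approx}(B)$.
   Context: $\Sigma^*$ is the set of strings over an alphabet $\Sigma$. For a string $T$, $|T|$ is its length, $T[i:j]$ the substring from position $i$ to $j$, $T[:j]=T[1:j]$, $T[i:]=T[i:|T|]$. An SCER (substring consistent equivalence relation) is an equivalence relation $\approx$ on $\Sigma^*$ such that $X\approx Y$ implies $|X|=|Y|$ and $X[i:j]\approx Y[i:j]$ for all $1\le i\le j\le|X|$. $\mathsf{Occ}_{P,T}=\{\,i : 1\le i\le |T|-|P|+1,\ P\approx T[i:i+|P|-1]\,\}$. $\mathsf{Bord}_\approx(T)$ is the set of strings $B$ with $B\approx T[:|B|]\approx T[|T|-|B|+1:]$. A string $C$ of length $c$ is a $\approx$-cover of $T$ of length $n$ if there are $x_1,\dots,x_m\in\mathsf{Occ}_{C,T}$ with $x_1=1$, $x_m=n-c+1$ and $x_{i-1}<x_i\le x_{i-1}+c$ for all $1<i\le m$; $\mathsf{Cov}_\approx(T)$ is the set of all $\approx$-covers of $T$. -}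

module Defs where

open import Level using (Level; _⊔_; suc)
open import Data.Nat using (ℕ; _+_; _∸_; _≤_; _<_)
open import Data.List using (List; length; take; drop)
open import Data.Product using (_×_)
open import Relation.Binary.Core using (Rel)
open import Relation.Binary.Structures using (IsEquivalence)
open import Relation.Binary.PropositionalEquality using (_≡_)

-- Strings over an alphabet A are lists.  Positions are 1-based, as in the paper.
-- sub T i j = T[i:j] (the substring from position i to position j, inclusive).
sub : {A : Set} → List A → ℕ → ℕ → List A
sub T i j = take ((j + 1) ∸ i) (drop (i ∸ 1) T)

record SCER (A : Set) (ℓ : Level) : Set (suc ℓ) where
  field
    _≈_     : Rel (List A) ℓ
    isEquiv : IsEquivalence _≈_
    len     : ∀ {X Y} → X ≈ Y → length X ≡ length Y
    substr  : ∀ {X Y} → X ≈ Y → ∀ i j → 1 ≤ i → i ≤ j → j ≤ length X →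
              sub X i j ≈ sub Y i j

module _ {A : Set} {ℓ : Level} (S : SCER A ℓ) where
  open SCER S

  -- i ∈ Occ_{P,T}: 1 ≤ i ≤ |T| - |P| + 1 (stated without truncated subtraction
  -- as i + |P| ≤ |T| + 1) and P ≈ T[i : i + |P| - 1].
  Occ : List A → List A → ℕ → Set ℓ
  Occ P T i = 1 ≤ i × i + length P ≤ length T + 1 × P ≈ sub T i ((i + length P) ∸ 1)

  Bord : List A → List A → Set ℓ
  Bord T B = B ≈ sub T 1 (length B)
           × sub T 1 (length B) ≈ sub T ((length T ∸ length B) + 1) (length T)

  data CoverChain (C T : List A) : ℕ → Set ℓ where
    last : ∀ {x} → Occ C T x → x ≡ (length T ∸ length C) + 1 → CoverChain C T x
    step : ∀ {x y} → Occ C T x → x < y → y ≤ x + length C →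
           CoverChain C T y → CoverChain C T x

  Cov : List A → List A → Set ℓ
  Cov T C = CoverChain C T 1

module Submission where

open import Defs
open import Level using (Level)
open import Data.Nat using (_≤_)
open import Data.List using (List; length)

open import Data.Nat using (ℕ; zero; suc; _+_; _∸_; _⊓_; _<_; z≤n; s≤s; _≤?_; _≟_)
open import Data.Nat.Properties
open import Data.List using ([]; _∷_; take; drop)
open import Data.List.Properties using (length-take; length-drop; take-take; drop-drop)
open import Data.Product using (_×_; _,_; proj₁; proj₂)
open import Relation.Nullary using (yes; no)
open import Relation.Binary.PropositionalEquality
open import Relation.Binary.Structures using (IsEquivalence)

-- Cut the cover of T after the last occurrence lying inside the prefix T[:|B|];
-- these are occurrences in B because B ≈ T[:|B|].  The next occurrence overshoots
-- B, so the gap condition lets the chain jump straight to |B| - |C| + 1, which is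
-- an occurrence in B because the suffix of T of length |B| is ≈ B and contains the
-- last occurrence of C in T.

-- seg T a l = T[a+1 : a+l], the segment of length l after the first a symbols.
seg : {A : Set} → List A → ℕ → ℕ → List A
seg T a l = take l (drop a T)

sub≡seg : {A : Set} (T : List A) (a l : ℕ) → sub T (suc a) (a + l) ≡ seg T a l
sub≡seg T a l = cong (λ k → take k (drop a T)) (begin
  (a + l + 1) ∸ suc a ≡⟨ cong (_∸ suc a) (+-comm (a + l) 1) ⟩
  suc (a + l) ∸ suc a ≡⟨ m+n∸m≡n a l ⟩
  l                   ∎)
  where open ≡-Reasoning

length-seg : {A : Set} (T : List A) (a l : ℕ) → length (seg T a l) ≡ l → l ≤ length T ∸ a
length-seg T a l eq = m⊓n≡m⇒m≤n (begin
  l ⊓ (length T ∸ a)     ≡⟨ cong (l ⊓_) (sym (length-drop a T)) ⟩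
  l ⊓ length (drop a T)  ≡⟨ sym (length-take l (drop a T)) ⟩
  length (seg T a l)     ≡⟨ eq ⟩
  l                      ∎)
  where open ≡-Reasoning

take-drop-take : {A : Set} (U : List A) (l a l' : ℕ) → a + l' ≤ l →
  take l' (drop a (take l U)) ≡ take l' (drop a U)
take-drop-take U l zero l' l'≤l =
  trans (take-take l' l U) (cong (λ k → take k U) (m≤n⇒m⊓n≡m l'≤l))
take-drop-take [] (suc l) (suc a) l' _ = refl
take-drop-take (x ∷ U) (suc l) (suc a) l' (s≤s le) = take-drop-take U l a l' le

seg-seg : {A : Set} (T : List A) (a l a' l' : ℕ) → a' + l' ≤ l →
  seg (seg T a l) a' l' ≡ seg T (a + a') l'
seg-seg T a l a' l' le =
  trans (take-drop-take (drop a T) l a' l' le) (cong (take l') (drop-drop a a' T))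

-- |T| - |C| + 1, where every cover chain of C in T ends.
lastPos : {A : Set} → List A → List A → ℕ
lastPos C T = (length T ∸ length C) + 1

module _ {A : Set} {ℓ : Level} (S : SCER A ℓ) where
  open SCER S
  open IsEquivalence isEquiv renaming (refl to ≈-refl; sym to ≈-sym; trans to ≈-trans)

  seg-cong : ∀ {X Y} → X ≈ Y → ∀ a l → a + l ≤ length X → seg X a l ≈ seg Y a l
  seg-cong e a zero _ = ≈-refl
  seg-cong {X} {Y} e a (suc l) le =
    subst₂ _≈_ (sub≡seg X a (suc l)) (sub≡seg Y a (suc l))
      (substr e (suc a) (a + suc l) (s≤s z≤n) a<a+suc[l] le)
    where
    a<a+suc[l] : suc a ≤ a + suc l
    a<a+suc[l] = ≤-trans (s≤s (m≤m+n a l)) (≤-reflexive (sym (+-suc a l)))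

  Occ⇒seg : ∀ {C T x} → Occ S C T (suc x) → x + length C ≤ length T × C ≈ seg T x (length C)
  Occ⇒seg {C} {T} {x} (_ , le , e) =
    ≤-pred (subst (suc (x + length C) ≤_) (+-comm (length T) 1) le) ,
    subst (C ≈_) (sub≡seg T x (length C)) e

  seg⇒Occ : ∀ {C T x} → x + length C ≤ length T → C ≈ seg T x (length C) → Occ S C T (suc x)
  seg⇒Occ {C} {T} {x} le e =
    s≤s z≤n ,
    subst (suc (x + length C) ≤_) (+-comm 1 (length T)) (s≤s le) ,
    subst (C ≈_) (sym (sub≡seg T x (length C))) e

  ≈seg⇒length≤ : ∀ {B T a} → B ≈ seg T a (length B) → length B ≤ length T ∸ a
  ≈seg⇒length≤ {B} {T} {a} e = length-seg T a (length B) (sym (len e))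

  Occ-restrict : ∀ {C B x} T a → B ≈ seg T a (length B) →
    1 ≤ x → x + length C ≤ length B + 1 → Occ S C T (a + x) → Occ S C B x
  Occ-restrict {C} {B} {suc x} T a e _ le o = seg⇒Occ inB (≈-trans C≈ (≈-sym segB≈))
    where
    c = length C
    inB : x + c ≤ length B
    inB = ≤-pred (subst (suc x + c ≤_) (+-comm (length B) 1) le)
    C≈ : C ≈ seg T (a + x) c
    C≈ = proj₂ (Occ⇒seg (subst (Occ S C T) (+-suc a x) o))
    segB≈ : seg B x c ≈ seg T (a + x) c
    segB≈ = subst (seg B x c ≈_) (seg-seg T a (length B) x c inB) (seg-cong e x c inB)

  CoverChain⇒Occ-lastPos : ∀ {C T x} → CoverChain S C T x → Occ S C T (lastPos C T)
  CoverChain⇒Occ-lastPos (last o refl) = o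
  CoverChain⇒Occ-lastPos (step _ _ _ ch) = CoverChain⇒Occ-lastPos ch

  module _ {C B : List A} (c≤b : length C ≤ length B) where
    private
      c = length C
      b = length B

    lastPos+length≡length+1 : lastPos C B + c ≡ b + 1
    lastPos+length≡length+1 = begin
      (b ∸ c) + 1 + c   ≡⟨ +-assoc (b ∸ c) 1 c ⟩
      (b ∸ c) + (1 + c) ≡⟨ cong ((b ∸ c) +_) (+-comm 1 c) ⟩
      (b ∸ c) + (c + 1) ≡⟨ sym (+-assoc (b ∸ c) c 1) ⟩
      (b ∸ c) + c + 1   ≡⟨ cong (_+ 1) (m∸n+n≡m c≤b) ⟩
      b + 1             ∎
      where open ≡-Reasoning

    CoverChain-close : ∀ {x} → Occ S C B (lastPos C B) → Occ S C B x → lastPos C B ≤ x + c →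
      CoverChain S C B x
    CoverChain-close {x} end o end≤ with x ≟ lastPos C B
    ... | yes refl = last o refl
    ... | no x≢end = step o (≤∧≢⇒< x≤end x≢end) end≤ (last end refl)
      where
      x≤end : x ≤ lastPos C B
      x≤end = subst (x ≤_) (+-∸-comm 1 c≤b) (m+n≤o⇒m≤o∸n x (proj₁ (proj₂ o)))

    CoverChain-cut : ∀ {T x} → B ≈ seg T 0 b → Occ S C B (lastPos C B) →
      CoverChain S C T x → x + c ≤ b + 1 → CoverChain S C B x
    CoverChain-cut {T} e end (last o refl) le =
      CoverChain-close end (Occ-restrict T 0 e (proj₁ o) le o)
        (≤-trans (+-monoˡ-≤ 1 (∸-monoˡ-≤ c (≈seg⇒length≤ {a = 0} e))) (m≤m+n _ c))
    CoverChain-cut {T} e end (step {y = y} o x<y y≤x+c ch) le with y + c ≤? b + 1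
    ... | yes y-inside =
      step (Occ-restrict T 0 e (proj₁ o) le o) x<y y≤x+c (CoverChain-cut e end ch y-inside)
    ... | no y-outside = CoverChain-close end (Occ-restrict T 0 e (proj₁ o) le o)
      (≤-trans (<⇒≤ end<y) y≤x+c)
      where
      end<y : lastPos C B < y
      end<y = +-cancelʳ-< c (lastPos C B) y
        (subst (_< y + c) (sym lastPos+length≡length+1) (≰⇒> y-outside))

lemma3 : {A : Set} {ℓ : Level} (S : SCER A ℓ) (T C B : List A) →
    Cov S T C → Bord S T B → length C ≤ length B → Cov S B C
lemma3 S T C B cov bord c≤b =
  CoverChain-cut S c≤b prefix lastInB cov (subst (1 + c ≤_) (+-comm 1 b) (s≤s c≤b))
  where
  open SCER S
  open IsEquivalence isEquiv using () renaming (trans to ≈-trans)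
  n = length T
  b = length B
  c = length C

  prefix : B ≈ seg T 0 b
  prefix = subst (B ≈_) (sub≡seg T 0 b) (proj₁ bord)

  b≤n : b ≤ n
  b≤n = ≈seg⇒length≤ S {a = 0} prefix

  suffix : B ≈ seg T (n ∸ b) b
  suffix = ≈-trans (proj₁ bord) (subst (sub T 1 b ≈_)
    (trans (cong₂ (sub T) (+-comm (n ∸ b) 1) (sym (m∸n+n≡m b≤n))) (sub≡seg T (n ∸ b) b))
    (proj₂ bord))

  lastInT : Occ S C T ((n ∸ b) + lastPos C B)
  lastInT = subst (Occ S C T) (begin
    (n ∸ c) + 1             ≡⟨ cong (λ m → (m ∸ c) + 1) (sym (m∸n+n≡m b≤n)) ⟩
    ((n ∸ b) + b ∸ c) + 1   ≡⟨ cong (_+ 1) (+-∸-assoc (n ∸ b) c≤b) ⟩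
    (n ∸ b) + (b ∸ c) + 1   ≡⟨ +-assoc (n ∸ b) (b ∸ c) 1 ⟩
    (n ∸ b) + lastPos C B   ∎)
    (CoverChain⇒Occ-lastPos S cov)
    where open ≡-Reasoning

  lastInB : Occ S C B (lastPos C B)
  lastInB = Occ-restrict S T (n ∸ b) suffix (m≤n+m 1 (b ∸ c))
    (≤-reflexive (lastPos+length≡length+1 S {C} {B} c≤b)) lastInT
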